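{- Let $k\ge 3$ and $d$ be positive integers and let $G$ be an oriented graph on $n$ vertices such that for every copy $C$ of $\overrightarrow{C}_k$ in $G$, every vertex of $G$ has at most $\frac{2k}{d}$ neighbors in $V(C)$. Then the number of copies of $\overrightarrow{C}_k$ in $G$ is at most $\frac{n}{k}\left(\frac{n}{d}\right)^{k-1}$.
   Context: An oriented graph is a directed graph without loops in which every pair of vertices is joined by at most one arc. $\overrightarrow{C}_k$ denotes the directed cycle of length $k$. A copy of $H$ in $G$ is a subgraph of $G$ isomorphic to $H$. A vertex $u$ is a neighbor of $v$ if $uv$ or $vu$ is an arc. -}

module Defs where

open import Data.Nat using (ℕ; zero; suc; _+_; _*_; _/_; _≟_)

open import Data.Nat.DivMod using (_%_; m%n<n)
open import Data.Fin using (Fin; toℕ; fromℕ<)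
import Data.Fin.Properties as FinP
open import Data.Vec using (Vec; []; _∷_; lookup)
open import Data.List using (List; [_]; concatMap; map; allFin; filter; length)
open import Data.Product using (_×_)
open import Data.Sum using (_⊎_)
open import Relation.Nullary using (¬_; Dec)
open import Relation.Nullary.Decidable using (_×-dec_; _⊎-dec_; _→-dec_)
open import Relation.Binary.PropositionalEquality using (_≡_)
open import Relation.Unary using (Decidable)

record OrientedGraph (n : ℕ) : Set₁ where
  field
    Arc      : Fin n → Fin n → Set
    arc?     : ∀ u v → Dec (Arc u v)
    loopless : ∀ v → ¬ Arc v v
    oriented : ∀ u v → ¬ (Arc u v × Arc v u)
open OrientedGraph public

Neighbour : ∀ {n} → OrientedGraph n → Fin n → Fin n → Set
Neighbour G u v = Arc G u v ⊎ Arc G v u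

neighbour? : ∀ {n} (G : OrientedGraph n) u v → Dec (Neighbour G u v)
neighbour? G u v = arc? G u v ⊎-dec arc? G v u

next : ∀ {k} → Fin k → Fin k
next {suc m} i = fromℕ< (m%n<n (suc (toℕ i)) (suc m))

IsLabelledCycle : ∀ {n k} → OrientedGraph n → Vec (Fin n) k → Set
IsLabelledCycle {n} {k} G c =
  (∀ (i j : Fin k) → lookup c i ≡ lookup c j → i ≡ j) ×
  (∀ (i : Fin k) → Arc G (lookup c i) (lookup c (next i)))

isLabelledCycle? : ∀ {n k} (G : OrientedGraph n) → Decidable (IsLabelledCycle {n} {k} G)
isLabelledCycle? G c =
  FinP.all? (λ i → FinP.all? (λ j → (lookup c i FinP.≟ lookup c j) →-dec (i FinP.≟ j)))
  ×-dec FinP.all? (λ i → arc? G (lookup c i) (lookup c (next i)))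

allVecs : (k n : ℕ) → List (Vec (Fin n) k)
allVecs zero    n = [ [] ]
allVecs (suc k) n = concatMap (λ x → map (x ∷_) (allVecs k n)) (allFin n)

labelledCycles : ∀ {n} (k : ℕ) → OrientedGraph n → List (Vec (Fin n) k)
labelledCycles {n} k G = filter (isLabelledCycle? G) (allVecs k n)

-- Each copy (subgraph isomorphic to the directed k-cycle, k ≥ 1) corresponds to
-- exactly k labelled copies (its k rotations), so the number of copies is:
numCopies : ∀ {n} (k : ℕ) → OrientedGraph n → ℕ
numCopies zero    G = 0
numCopies (suc m) G = length (labelledCycles (suc m) G) / suc m

-- number of vertices of V(C) that are neighbours of v, for a copy given by c
-- (c is injective, so counting positions counts vertices)
neighboursIn : ∀ {n k} → OrientedGraph n → Vec (Fin n) k → Fin n → ℕ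
neighboursIn {n} {k} G c v = length (filter (λ i → neighbour? G v (lookup c i)) (allFin k))

{-# OPTIONS --safe #-}
module Submission where

-- Weight a walk by the probability that the random walk choosing a uniform out-neighbour follows
-- it (the product of 1/d⁺ over all but its last vertex), or by the same for the reversed walk along
-- in-arcs (the product of 1/d⁻ over all but its first vertex). Summed over all vertex sequences of
-- length k, either weight totals at most n. The k rotations of a labelled k-cycle C give 2k such
-- weights with product (∏_{u ∈ C} d⁺(u) d⁻(u))^-(k-1). Since Σ_{u ∈ C} (d⁺(u) + d⁻(u)) =
-- Σ_v |N(v) ∩ C| ≤ 2kn/d, AM–GM bounds this product below by (d/n)^(2k(k-1)), and AM–GM again
-- bounds the sum of the 2k weights below by 2k (d/n)^(k-1). Against the total 2kn this leaves at
-- most n^k / d^(k-1) labelled cycles, k for each copy. All weights are scaled by n! to stay in ℕ.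

open import Defs
open import Data.Nat
open import Data.Nat.Properties
open import Data.Nat.Divisibility using (∣-trans; m∣m*n; m≤n⇒m!∣n!)
open import Data.Nat.DivMod using (m/n*n≤m; m/n*n≡m; m≤n⇒m%n≡m; n%n≡0)
open import Data.Nat.ListAction using (sum; product)
open import Data.Nat.ListAction.Properties using (sum-++; product-++)
open import Data.Nat.Tactic.RingSolver using (solve-∀)
open import Data.List using (List; []; _∷_; _++_; [_]; _∷ʳ_; map; concatMap; length; allFin; filter; tabulate)
open import Data.List.Properties
  using (map-++; map-cong; map-∘; map-tabulate; length-tabulate; length-++; length-map; ++-assoc; ++-identityʳ)
open import Data.List.Membership.Propositional using (_∈_)
open import Data.List.Membership.Propositional.Properties using (∈-allFin)
open import Data.List.Relation.Unary.Any using (here; there)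
open import Data.List.Relation.Unary.All using (All; []; _∷_)
import Data.List.Relation.Unary.All as All
open import Data.List.Relation.Unary.All.Properties using (∷ʳ⁻)
open import Data.List.Relation.Unary.Linked using (Linked; []; [-]; _∷_)
import Data.List.Relation.Unary.Linked as Linked
open import Data.Fin using (Fin; zero; suc; toℕ; inject₁; fromℕ)
open import Data.Fin.Properties using (toℕ-injective; toℕ-fromℕ<; toℕ-inject₁; toℕ<n; toℕ-fromℕ)
open import Data.Vec as Vec using (Vec; []; _∷_; toList; lookup)
open import Data.Vec.Properties using (length-toList; toList-∷ʳ)
open import Data.Empty using (⊥; ⊥-elim)
open import Data.Product using (∃; _,_)
open import Data.Sum using (inj₁; inj₂)
open import Function using (_∘_)
open import Relation.Nullary using (Dec; yes; no; ¬_; contradiction)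
open import Relation.Binary.PropositionalEquality hiding ([_])
open import Algebra.Properties.CommutativeSemigroup +-commutativeSemigroup
  using () renaming (interchange to +-interchange)
open import Algebra.Properties.CommutativeSemigroup *-commutativeSemigroup
  using () renaming (interchange to *-interchange; x∙yz≈y∙xz to *-x∙yz≈y∙xz)

private variable A B : Set

^-distribʳ-* : ∀ m n o → (m * n) ^ o ≡ m ^ o * n ^ o
^-distribʳ-* m n zero    = refl
^-distribʳ-* m n (suc o) = begin
  m * n * (m * n) ^ o       ≡⟨ cong (m * n *_) (^-distribʳ-* m n o) ⟩
  m * n * (m ^ o * n ^ o)   ≡⟨ *-interchange m n (m ^ o) (n ^ o) ⟩
  m * m ^ o * (n * n ^ o)   ∎
  where open ≡-Reasoning

^-comm-exponents : ∀ m n o → (m ^ n) ^ o ≡ (m ^ o) ^ n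
^-comm-exponents m n o = begin
  (m ^ n) ^ o  ≡⟨ ^-*-assoc m n o ⟩
  m ^ (n * o)  ≡⟨ cong (m ^_) (*-comm n o) ⟩
  m ^ (o * n)  ≡⟨ ^-*-assoc m o n ⟨
  (m ^ o) ^ n  ∎
  where open ≡-Reasoning

^-cancelʳ-≤ : ∀ n .{{_ : NonZero n}} {m o} → m ^ n ≤ o ^ n → m ≤ o
^-cancelʳ-≤ n {m} {o} mⁿ≤oⁿ with m ≤? o
... | yes m≤o = m≤o
... | no  m≰o = contradiction mⁿ≤oⁿ (<⇒≱ (^-monoˡ-< n (≰⇒> m≰o)))

rearrangement : ∀ {a b y z} → b ≤ a → z ≤ y → a * z + b * y ≤ a * y + b * z
rearrangement {b = b} {z = z} b≤a z≤y with m≤n⇒∃[o]m+o≡n b≤a | m≤n⇒∃[o]m+o≡n z≤y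
... | f , refl | e , refl = begin
  (b + f) * z + b * (z + e)              ≤⟨ m≤m+n _ (f * e) ⟩
  (b + f) * z + b * (z + e) + f * e      ≡⟨ expand b f z e ⟩
  (b + f) * (z + e) + b * z              ∎
  where
  open ≤-Reasoning
  expand : ∀ b f z e → (b + f) * z + b * (z + e) + f * e ≡ (b + f) * (z + e) + b * z
  expand = solve-∀

^-rearrangement : ∀ j y z → y ^ j * z + z ^ j * y ≤ y ^ j * y + z ^ j * z
^-rearrangement j y z with ≤-total z y
... | inj₁ z≤y = rearrangement (^-monoˡ-≤ j z≤y) z≤y
... | inj₂ y≤z = subst₂ _≤_ (+-comm (z ^ j * y) (y ^ j * z)) (+-comm (z ^ j * z) (y ^ j * y))
                   (rearrangement (^-monoˡ-≤ j y≤z) y≤z)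

weighted-amgm : ∀ m y z → suc m * y * z ^ m ≤ y ^ suc m + m * z ^ suc m
weighted-amgm zero    y z = ≤-reflexive (units y)
  where
  units : ∀ y → 1 * y * 1 ≡ y * 1 + 0
  units = solve-∀
weighted-amgm (suc m) y z = begin
  suc (suc m) * y * (z * zᵐ)                  ≡⟨ split (suc m) y z zᵐ ⟩
  suc m * y * zᵐ * z + z * zᵐ * y             ≤⟨ +-monoˡ-≤ (z * zᵐ * y) (*-monoˡ-≤ z (weighted-amgm m y z)) ⟩
  (yᵐ⁺¹ + m * (z * zᵐ)) * z + z * zᵐ * y      ≡⟨ regroup yᵐ⁺¹ m z zᵐ y ⟩
  (yᵐ⁺¹ * z + z * zᵐ * y) + m * (z * zᵐ) * z  ≤⟨ +-monoˡ-≤ _ (^-rearrangement (suc m) y z) ⟩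
  (yᵐ⁺¹ * y + z * zᵐ * z) + m * (z * zᵐ) * z  ≡⟨ collect yᵐ⁺¹ y z zᵐ m ⟩
  y * yᵐ⁺¹ + suc m * (z * (z * zᵐ))           ∎
  where
  open ≤-Reasoning
  zᵐ = z ^ m
  yᵐ⁺¹ = y ^ suc m
  split : ∀ k y z zᵐ → (1 + k) * y * (z * zᵐ) ≡ k * y * zᵐ * z + z * zᵐ * y
  split = solve-∀
  regroup : ∀ Y m z zᵐ y → (Y + m * (z * zᵐ)) * z + z * zᵐ * y ≡ (Y * z + z * zᵐ * y) + m * (z * zᵐ) * z
  regroup = solve-∀
  collect : ∀ Y y z zᵐ m → (Y * y + z * zᵐ * z) + m * (z * zᵐ) * z ≡ y * Y + (1 + m) * (z * (z * zᵐ))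
  collect = solve-∀

-- weighted-amgm at y = m (x + s) and z = (1 + m) s, then cancel m (1 + m) ^ (1 + m) s ^ (1 + m) and m.
amgm-step : ∀ m x s → suc m ^ suc m * x * s ^ m ≤ m ^ m * (x + s) ^ suc m
amgm-step zero x s = subst₂ _≤_ (units-x x) (units-xs x s) (m≤m+n x s)
  where
  units-x : ∀ x → x ≡ 1 * 1 * x * 1
  units-x = solve-∀
  units-xs : ∀ x s → x + s ≡ 1 * ((x + s) * 1)
  units-xs = solve-∀
amgm-step m@(suc _) x s = *-cancelˡ-≤ m (+-cancelʳ-≤ common _ _ (begin
  m * (M * Mᵐ * x * sᵐ) + common            ≡⟨ lhs M m x s Mᵐ sᵐ ⟩
  M * (m * (x + s)) * (Mᵐ * sᵐ)             ≡⟨ cong (M * (m * (x + s)) *_) (^-distribʳ-* M s m) ⟨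
  M * (m * (x + s)) * (M * s) ^ m           ≤⟨ weighted-amgm m (m * (x + s)) (M * s) ⟩
  (m * (x + s)) ^ M + m * (M * s) ^ M       ≡⟨ cong₂ _+_ (^-distribʳ-* m (x + s) M) (cong (m *_) (^-distribʳ-* M s M)) ⟩
  m ^ M * (x + s) ^ M + m * (M ^ M * s ^ M) ≡⟨ cong (_+ common) (*-assoc m mᵐ ((x + s) ^ M)) ⟩
  m * (mᵐ * (x + s) ^ M) + common           ∎))
  where
  open ≤-Reasoning
  M = suc m
  Mᵐ = M ^ m
  mᵐ = m ^ m
  sᵐ = s ^ m
  common = m * (M ^ M * s ^ M)
  lhs : ∀ M m x s Mᵐ sᵐ → m * (M * Mᵐ * x * sᵐ) + m * (M * Mᵐ * (s * sᵐ)) ≡ M * (m * (x + s)) * (Mᵐ * sᵐ)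
  lhs = solve-∀

nⁿ≢0 : ∀ n → NonZero (n ^ n)
nⁿ≢0 zero        = _
nⁿ≢0 n@(suc _)   = m^n≢0 n n

amgm : ∀ xs → length xs ^ length xs * product xs ≤ sum xs ^ length xs
amgm []       = ≤-refl
amgm (x ∷ xs) = *-cancelˡ-≤ (m ^ m) {{nⁿ≢0 m}} (begin
  m ^ m * (Mᴹ * (x * p))  ≡⟨ shuffle Mᴹ x p (m ^ m) ⟩
  Mᴹ * x * (m ^ m * p)    ≤⟨ *-monoʳ-≤ (Mᴹ * x) (amgm xs) ⟩
  Mᴹ * x * s ^ m          ≤⟨ amgm-step m x s ⟩
  m ^ m * (x + s) ^ suc m ∎)
  where
  open ≤-Reasoning
  m = length xs
  s = sum xs
  p = product xs
  Mᴹ = suc m ^ suc m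
  shuffle : ∀ a x p q → q * (a * (x * p)) ≡ a * x * (q * p)
  shuffle = solve-∀

amgm-bound : ∀ {d n} xs → d * sum xs ≤ n * length xs → d ^ length xs * product xs ≤ n ^ length xs
amgm-bound {d} {n} xs d*s≤n*L = *-cancelˡ-≤ (L ^ L) {{nⁿ≢0 L}} (begin
  L ^ L * (d ^ L * product xs)  ≡⟨ *-x∙yz≈y∙xz (L ^ L) (d ^ L) (product xs) ⟩
  d ^ L * (L ^ L * product xs)  ≤⟨ *-monoʳ-≤ (d ^ L) (amgm xs) ⟩
  d ^ L * sum xs ^ L            ≡⟨ ^-distribʳ-* d (sum xs) L ⟨
  (d * sum xs) ^ L              ≤⟨ ^-monoˡ-≤ L d*s≤n*L ⟩
  (n * L) ^ L                   ≡⟨ ^-distribʳ-* n L L ⟩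
  n ^ L * L ^ L                 ≡⟨ *-comm (n ^ L) (L ^ L) ⟩
  L ^ L * n ^ L                 ∎)
  where
  open ≤-Reasoning
  L = length xs

cycle-arithmetic : ∀ m {n d F S a b p r} → let K = suc m; E = K + K in
  a * p ≡ F ^ K → b * r ≡ F ^ K → d ^ E * (a * b) ≤ n ^ E → E ^ E * (p ^ m * r ^ m) ≤ S ^ E →
  E * F ^ m * d ^ m ≤ n ^ m * S
cycle-arithmetic m {n} {d} {F} {S} {a} {b} {p} {r} ap≡Fᴷ br≡Fᴷ degrees terms = ^-cancelʳ-≤ E (begin
  (E * F ^ m * d ^ m) ^ E                  ≡⟨ ^-distribʳ-* (E * F ^ m) (d ^ m) E ⟩
  (E * F ^ m) ^ E * (d ^ m) ^ E            ≡⟨ cong (_* (d ^ m) ^ E) (^-distribʳ-* E (F ^ m) E) ⟩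
  E ^ E * (F ^ m) ^ E * (d ^ m) ^ E        ≡⟨ cong₂ (λ x y → E ^ E * x * y) (^-comm-exponents F m E) (^-comm-exponents d m E) ⟩
  E ^ E * (F ^ E) ^ m * (d ^ E) ^ m        ≡⟨ *-assoc (E ^ E) _ _ ⟩
  E ^ E * ((F ^ E) ^ m * (d ^ E) ^ m)      ≡⟨ cong (E ^ E *_) (^-distribʳ-* (F ^ E) (d ^ E) m) ⟨
  E ^ E * (F ^ E * d ^ E) ^ m              ≡⟨ cong (λ x → E ^ E * (x * d ^ E) ^ m) Fᴱ≡apbr ⟩
  E ^ E * (a * p * (b * r) * d ^ E) ^ m    ≡⟨ cong (λ x → E ^ E * x ^ m) (regroup a p b r (d ^ E)) ⟩
  E ^ E * (d ^ E * (a * b) * (p * r)) ^ m  ≤⟨ *-monoʳ-≤ (E ^ E) (^-monoˡ-≤ m (*-monoˡ-≤ (p * r) degrees)) ⟩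
  E ^ E * (n ^ E * (p * r)) ^ m            ≡⟨ cong (E ^ E *_) (^-distribʳ-* (n ^ E) (p * r) m) ⟩
  E ^ E * ((n ^ E) ^ m * (p * r) ^ m)      ≡⟨ cong₂ (λ x y → E ^ E * (x * y)) (^-comm-exponents n E m) (^-distribʳ-* p r m) ⟩
  E ^ E * ((n ^ m) ^ E * (p ^ m * r ^ m))  ≡⟨ *-x∙yz≈y∙xz (E ^ E) ((n ^ m) ^ E) _ ⟩
  (n ^ m) ^ E * (E ^ E * (p ^ m * r ^ m))  ≤⟨ *-monoʳ-≤ ((n ^ m) ^ E) terms ⟩
  (n ^ m) ^ E * S ^ E                      ≡⟨ ^-distribʳ-* (n ^ m) S E ⟨
  (n ^ m * S) ^ E                          ∎)
  where
  open ≤-Reasoning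
  K = suc m
  E = K + K
  Fᴱ≡apbr : F ^ E ≡ a * p * (b * r)
  Fᴱ≡apbr = trans (^-distribˡ-+-* F K K) (sym (cong₂ _*_ ap≡Fᴷ br≡Fᴷ))
  regroup : ∀ a p b r x → a * p * (b * r) * x ≡ x * (a * b) * (p * r)
  regroup = solve-∀

*-cancel-last-factor : ∀ {s p m} .{{_ : NonZero p}} → s * p ≡ p ^ suc m → s ≡ p ^ m
*-cancel-last-factor {s} {p} {m} s*p≡pᵐ⁺¹ = *-cancelʳ-≡ s (p ^ m) p (trans s*p≡pᵐ⁺¹ (*-comm p (p ^ m)))

indicator : {P : Set} → Dec P → ℕ
indicator (yes _) = 1
indicator (no  _) = 0

∑ : {A : Set} → List A → (A → ℕ) → ℕ
∑ xs f = sum (map f xs)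

syntax ∑ xs (λ x → e) = ∑[ x ∈ xs ] e

∑-cong : ∀ {f g : A → ℕ} xs → (∀ x → f x ≡ g x) → ∑ xs f ≡ ∑ xs g
∑-cong xs f≗g = cong sum (map-cong f≗g xs)

∑-mono : ∀ {f g : A → ℕ} xs → (∀ x → f x ≤ g x) → ∑ xs f ≤ ∑ xs g
∑-mono []       f≤g = z≤n
∑-mono (x ∷ xs) f≤g = +-mono-≤ (f≤g x) (∑-mono xs f≤g)

∑-+ : ∀ (f g : A → ℕ) xs → ∑[ x ∈ xs ] (f x + g x) ≡ ∑ xs f + ∑ xs g
∑-+ f g []       = refl
∑-+ f g (x ∷ xs) = trans (cong (f x + g x +_) (∑-+ f g xs)) (+-interchange (f x) (g x) _ _)

∑-*ˡ : ∀ c (f : A → ℕ) xs → ∑[ x ∈ xs ] (c * f x) ≡ c * ∑ xs f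
∑-*ˡ c f []       = sym (*-zeroʳ c)
∑-*ˡ c f (x ∷ xs) = trans (cong (c * f x +_) (∑-*ˡ c f xs)) (sym (*-distribˡ-+ c (f x) _))

∑-*ʳ : ∀ c (f : A → ℕ) xs → ∑[ x ∈ xs ] (f x * c) ≡ ∑ xs f * c
∑-*ʳ c f xs = begin
  ∑[ x ∈ xs ] (f x * c)  ≡⟨ ∑-cong xs (λ x → *-comm (f x) c) ⟩
  ∑[ x ∈ xs ] (c * f x)  ≡⟨ ∑-*ˡ c f xs ⟩
  c * ∑ xs f             ≡⟨ *-comm c (∑ xs f) ⟩
  ∑ xs f * c             ∎
  where open ≡-Reasoning

∑-const : ∀ c (xs : List A) → ∑[ x ∈ xs ] c ≡ length xs * c
∑-const c []       = refl
∑-const c (x ∷ xs) = cong (c +_) (∑-const c xs)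

∑-++ : ∀ (f : A → ℕ) xs ys → ∑ (xs ++ ys) f ≡ ∑ xs f + ∑ ys f
∑-++ f xs ys = trans (cong sum (map-++ f xs ys)) (sum-++ (map f xs) (map f ys))

∑-∈ : ∀ (f : A → ℕ) {x xs} → x ∈ xs → f x ≤ ∑ xs f
∑-∈ f {xs = y ∷ xs} (here refl) = m≤m+n (f y) _
∑-∈ f {xs = y ∷ xs} (there x∈xs) = ≤-trans (∑-∈ f x∈xs) (m≤n+m _ (f y))

length-filter≡∑ : ∀ {P : A → Set} (P? : ∀ x → Dec (P x)) xs →
  length (filter P? xs) ≡ ∑[ x ∈ xs ] indicator (P? x)
length-filter≡∑ P? []       = refl
length-filter≡∑ P? (x ∷ xs) with P? x
... | yes _ = cong suc (length-filter≡∑ P? xs)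
... | no  _ = length-filter≡∑ P? xs

∑-map : ∀ (f : B → ℕ) (h : A → B) xs → ∑ (map h xs) f ≡ ∑[ x ∈ xs ] f (h x)
∑-map f h xs = cong sum (sym (map-∘ xs))

∑-concatMap : ∀ (f : B → ℕ) (g : A → List B) xs → ∑ (concatMap g xs) f ≡ ∑[ x ∈ xs ] ∑ (g x) f
∑-concatMap f g []       = refl
∑-concatMap f g (x ∷ xs) = trans (∑-++ f (g x) (concatMap g xs)) (cong (∑ (g x) f +_) (∑-concatMap f g xs))

∑-swap : ∀ (f : A → B → ℕ) xs ys → ∑[ x ∈ xs ] ∑[ y ∈ ys ] f x y ≡ ∑[ y ∈ ys ] ∑[ x ∈ xs ] f x y
∑-swap f []       ys = sym (trans (∑-const 0 ys) (*-zeroʳ (length ys)))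
∑-swap f (x ∷ xs) ys = begin
  (∑[ y ∈ ys ] f x y) + (∑[ x ∈ xs ] ∑[ y ∈ ys ] f x y)  ≡⟨ cong (∑ ys (f x) +_) (∑-swap f xs ys) ⟩
  (∑[ y ∈ ys ] f x y) + (∑[ y ∈ ys ] ∑[ x ∈ xs ] f x y)  ≡⟨ ∑-+ (f x) (λ y → ∑[ x ∈ xs ] f x y) ys ⟨
  ∑[ y ∈ ys ] (f x y + ∑[ x ∈ xs ] f x y)            ∎
  where open ≡-Reasoning

∑-allFin-const : ∀ n c → ∑[ i ∈ allFin n ] c ≡ n * c
∑-allFin-const n c = trans (∑-const c (allFin n)) (cong (_* c) (length-tabulate {n = n} (λ i → i)))

∑-allFin-lookup : ∀ {k} (f : A → ℕ) (c : Vec A k) → ∑[ i ∈ allFin k ] f (lookup c i) ≡ ∑ (toList c) f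
∑-allFin-lookup f c = begin
  ∑[ i ∈ allFin _ ] f (lookup c i)  ≡⟨ ∑-map f (lookup c) (allFin _) ⟨
  ∑ (map (lookup c) (allFin _)) f   ≡⟨ cong (λ xs → ∑ xs f) (trans (map-tabulate (λ i → i) (lookup c)) (tabulate-lookup c)) ⟩
  ∑ (toList c) f                    ∎
  where
  open ≡-Reasoning
  tabulate-lookup : ∀ {k} (c : Vec A k) → tabulate (lookup c) ≡ toList c
  tabulate-lookup []      = refl
  tabulate-lookup (x ∷ c) = cong (x ∷_) (tabulate-lookup c)

∑-allVecs-∷ : ∀ m n (f : Vec (Fin n) (suc m) → ℕ) →
  ∑ (allVecs (suc m) n) f ≡ ∑[ x ∈ allFin n ] ∑[ v ∈ allVecs m n ] f (x ∷ v)
∑-allVecs-∷ m n f = trans (∑-concatMap f (λ x → map (x ∷_) (allVecs m n)) (allFin n))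
                          (∑-cong (allFin n) (λ x → ∑-map f (x ∷_) (allVecs m n)))

∑-allVecs-∷ʳ : ∀ m n (f : Vec (Fin n) (suc m) → ℕ) →
  ∑ (allVecs (suc m) n) f ≡ ∑[ v ∈ allVecs m n ] ∑[ x ∈ allFin n ] f (v Vec.∷ʳ x)
∑-allVecs-∷ʳ zero    n f = begin
  ∑ (allVecs 1 n) f                         ≡⟨ ∑-allVecs-∷ zero n f ⟩
  ∑[ x ∈ allFin n ] (f (x ∷ []) + 0)        ≡⟨ ∑-cong (allFin n) (λ x → +-identityʳ (f (x ∷ []))) ⟩
  ∑[ x ∈ allFin n ] f (x ∷ [])              ≡⟨ +-identityʳ _ ⟨
  ∑[ x ∈ allFin n ] f (x ∷ []) + 0          ∎
  where open ≡-Reasoning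
∑-allVecs-∷ʳ (suc m) n f = begin
  ∑ (allVecs (suc (suc m)) n) f
    ≡⟨ ∑-allVecs-∷ (suc m) n f ⟩
  ∑[ y ∈ allFin n ] ∑[ v ∈ allVecs (suc m) n ] f (y ∷ v)
    ≡⟨ ∑-cong (allFin n) (λ y → ∑-allVecs-∷ʳ m n (λ v → f (y ∷ v))) ⟩
  ∑[ y ∈ allFin n ] ∑[ u ∈ allVecs m n ] ∑[ x ∈ allFin n ] f (y ∷ (u Vec.∷ʳ x))
    ≡⟨ ∑-allVecs-∷ m n _ ⟨
  ∑[ u ∈ allVecs (suc m) n ] ∑[ x ∈ allFin n ] f (u Vec.∷ʳ x)
    ∎
  where open ≡-Reasoning

rotate : List A → List A
rotate []       = []
rotate (x ∷ xs) = xs ∷ʳ x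

rotations : ℕ → List A → List (List A)
rotations zero    w = []
rotations (suc j) w = w ∷ rotations j (rotate w)

length-rotations : ∀ j (w : List A) → length (rotations j w) ≡ j
length-rotations zero    w = refl
length-rotations (suc j) w = cong suc (length-rotations j (rotate w))

∑-allVecs-rotate : ∀ m n (h : List (Fin n) → ℕ) →
  ∑[ v ∈ allVecs (suc m) n ] h (rotate (toList v)) ≡ ∑[ v ∈ allVecs (suc m) n ] h (toList v)
∑-allVecs-rotate m n h = begin
  ∑[ v ∈ allVecs (suc m) n ] h (rotate (toList v))
    ≡⟨ ∑-allVecs-∷ m n _ ⟩
  ∑[ x ∈ allFin n ] ∑[ u ∈ allVecs m n ] h (toList u ∷ʳ x)
    ≡⟨ ∑-swap (λ x u → h (toList u ∷ʳ x)) (allFin n) (allVecs m n) ⟩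
  ∑[ u ∈ allVecs m n ] ∑[ x ∈ allFin n ] h (toList u ∷ʳ x)
    ≡⟨ ∑-cong (allVecs m n) (λ u → ∑-cong (allFin n) (λ x → cong h (toList-∷ʳ x u))) ⟨
  ∑[ u ∈ allVecs m n ] ∑[ x ∈ allFin n ] h (toList (u Vec.∷ʳ x))
    ≡⟨ ∑-allVecs-∷ʳ m n _ ⟨
  ∑[ v ∈ allVecs (suc m) n ] h (toList v)
    ∎
  where open ≡-Reasoning

∑-allVecs-rotations : ∀ m n j (h : List (Fin n) → ℕ) →
  ∑[ v ∈ allVecs (suc m) n ] ∑ (rotations j (toList v)) h ≡ j * ∑[ v ∈ allVecs (suc m) n ] h (toList v)
∑-allVecs-rotations m n zero    h = trans (∑-const 0 (allVecs (suc m) n)) (*-zeroʳ (length (allVecs (suc m) n)))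
∑-allVecs-rotations m n (suc j) h = begin
  ∑[ v ∈ Vs ] (h (toList v) + ∑ (rotations j (rotate (toList v))) h)     ≡⟨ ∑-+ _ _ Vs ⟩
  ∑[ v ∈ Vs ] h (toList v) + ∑[ v ∈ Vs ] ∑ (rotations j (rotate (toList v))) h
    ≡⟨ cong (∑[ v ∈ Vs ] h (toList v) +_) (∑-allVecs-rotate m n (λ w → ∑ (rotations j w) h)) ⟩
  ∑[ v ∈ Vs ] h (toList v) + ∑[ v ∈ Vs ] ∑ (rotations j (toList v)) h
    ≡⟨ cong (∑[ v ∈ Vs ] h (toList v) +_) (∑-allVecs-rotations m n j h) ⟩
  ∑[ v ∈ Vs ] h (toList v) + j * ∑[ v ∈ Vs ] h (toList v)                ∎
  where
  open ≡-Reasoning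
  Vs = allVecs (suc m) n

product-map-* : ∀ {f g : A → ℕ} {c} {xs} → All (λ x → f x * g x ≡ c) xs →
  product (map f xs) * product (map g xs) ≡ c ^ length xs
product-map-* []                    = refl
product-map-* {f = f} {g} (fg≡c ∷ fgs≡c) =
  trans (*-interchange (f _) _ (g _) _) (cong₂ _*_ fg≡c (product-map-* fgs≡c))

product-map-rotate : ∀ (f : A → ℕ) w → product (map f (rotate w)) ≡ product (map f w)
product-map-rotate f []       = refl
product-map-rotate f (x ∷ xs) = begin
  product (map f (xs ∷ʳ x))            ≡⟨ cong product (map-++ f xs [ x ]) ⟩
  product (map f xs ++ [ f x ])        ≡⟨ product-++ (map f xs) [ f x ] ⟩
  product (map f xs) * (f x * 1)       ≡⟨ cong (product (map f xs) *_) (*-identityʳ (f x)) ⟩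
  product (map f xs) * f x             ≡⟨ *-comm (product (map f xs)) (f x) ⟩
  f x * product (map f xs)             ∎
  where open ≡-Reasoning

module _ {P : List A → Set} (P-rotate : ∀ {w} → P w → P (rotate w)) (¬P[] : ¬ P [])
         (f : A → ℕ) (g : List A → ℕ)
         (g*f-head : ∀ {x xs} → P (x ∷ xs) → g (x ∷ xs) * f x ≡ product (map f (x ∷ xs))) where

  -- The rotation x ∷ xs contributes every factor f except f x, and the heads of the successive
  -- rotations run through w once.
  product-rotations : ∀ {m w} → P w → length w ≡ suc m → .{{_ : NonZero (product (map f w))}} →
    product (map g (rotations (suc m) w)) ≡ product (map f w) ^ m
  product-rotations {m} {w} Pw |w|≡1+m = *-cancel-last-factor {m = m} (begin
    product (map g (rotations (suc m) w)) * product (map f w)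
      ≡⟨ cong (λ hs → product (map g (rotations (suc m) w)) * product (map f hs)) heads-all ⟨
    product (map g (rotations (suc m) w)) * product (map f (heads (suc m) w))
      ≡⟨ go (suc m) w Pw ⟩
    product (map f w) ^ suc m ∎)
    where
    open ≡-Reasoning
    heads : ℕ → List A → List A
    heads zero    w        = []
    heads (suc j) []       = []
    heads (suc j) (x ∷ xs) = x ∷ heads j (rotate (x ∷ xs))
    heads-++ : ∀ xs ys → heads (length xs) (xs ++ ys) ≡ xs
    heads-++ []       ys = refl
    heads-++ (x ∷ xs) ys = cong (x ∷_) (trans (cong (heads (length xs)) (++-assoc xs ys [ x ])) (heads-++ xs (ys ∷ʳ x)))
    heads-all : heads (suc m) w ≡ w
    heads-all = subst (λ k → heads k w ≡ w) |w|≡1+m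
                      (trans (cong (heads (length w)) (sym (++-identityʳ w))) (heads-++ w []))
    go : ∀ j w → P w → product (map g (rotations j w)) * product (map f (heads j w)) ≡ product (map f w) ^ j
    go zero    w          Pw = refl
    go (suc j) []         Pw = contradiction Pw ¬P[]
    go (suc j) w@(x ∷ xs) Pw = begin
      g w * G * (f x * H)   ≡⟨ *-interchange (g w) G (f x) H ⟩
      g w * f x * (G * H)   ≡⟨ cong₂ _*_ (g*f-head Pw) (trans (go j (rotate w) (P-rotate Pw)) (cong (_^ j) (product-map-rotate f w))) ⟩
      Π * Π ^ j             ∎
      where
      G = product (map g (rotations j (rotate w)))
      H = product (map f (heads j (rotate w)))
      Π = product (map f w)

walkWeight : (A → A → ℕ) → List A → ℕ
walkWeight W []          = 1
walkWeight W (x ∷ [])    = 1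
walkWeight W (x ∷ y ∷ w) = W x y * walkWeight W (y ∷ w)

ClosedWalk : (A → A → Set) → List A → Set
ClosedWalk R []       = ⊥
ClosedWalk R (x ∷ xs) = Linked R (x ∷ xs ∷ʳ x)

module _ {R : A → A → Set} where

  Linked-∷ʳ : ∀ xs {x y} → Linked R (xs ∷ʳ x) → R x y → Linked R (xs ∷ʳ x ∷ʳ y)
  Linked-∷ʳ []           [-]       xRy = xRy ∷ [-]
  Linked-∷ʳ (u ∷ [])     (r ∷ [-]) xRy = r ∷ xRy ∷ [-]
  Linked-∷ʳ (u ∷ v ∷ vs) (r ∷ l)   xRy = r ∷ Linked-∷ʳ (v ∷ vs) l xRy

  Linked-∷ʳ⁻ : ∀ xs {y} → Linked R (xs ∷ʳ y) → Linked R xs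
  Linked-∷ʳ⁻ []           _       = []
  Linked-∷ʳ⁻ (u ∷ [])     _       = [-]
  Linked-∷ʳ⁻ (u ∷ v ∷ vs) (r ∷ l) = r ∷ Linked-∷ʳ⁻ (v ∷ vs) l

  Linked-successors : ∀ xs {y} → Linked R (xs ∷ʳ y) → All (λ u → ∃ (R u)) xs
  Linked-successors []           _         = []
  Linked-successors (u ∷ [])     (r ∷ [-]) = (_ , r) ∷ []
  Linked-successors (u ∷ v ∷ vs) (r ∷ l)   = (_ , r) ∷ Linked-successors (v ∷ vs) l

  Linked-predecessors : ∀ {y} xs → Linked R (y ∷ xs) → All (λ u → ∃ λ v → R v u) xs
  Linked-predecessors []       _       = []
  Linked-predecessors (u ∷ us) (r ∷ l) = (_ , r) ∷ Linked-predecessors us l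

  closedWalk-rotate : ∀ {w} → ClosedWalk R w → ClosedWalk R (rotate w)
  closedWalk-rotate {x ∷ []}     l       = l
  closedWalk-rotate {x ∷ y ∷ ys} (r ∷ l) = Linked-∷ʳ (y ∷ ys) l r

  closedWalk-successors : ∀ {w} → ClosedWalk R w → All (λ u → ∃ (R u)) w
  closedWalk-successors {x ∷ xs} l = Linked-successors (x ∷ xs) l

  closedWalk-predecessors : ∀ {w} → ClosedWalk R w → All (λ u → ∃ λ v → R v u) w
  closedWalk-predecessors {x ∷ xs} l with ∷ʳ⁻ (Linked-predecessors (xs ∷ʳ x) l)
  ... | preds , pred-x = pred-x ∷ preds

  module _ {W : A → A → ℕ} where

    walkWeight-by-source : ∀ {f : A → ℕ} → (∀ {x y} → R x y → W x y ≡ f x) →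
      ∀ xs {y} → Linked R (xs ∷ʳ y) → walkWeight W (xs ∷ʳ y) ≡ product (map f xs)
    walkWeight-by-source W≡f []           _       = refl
    walkWeight-by-source W≡f (u ∷ [])     (r ∷ l) = cong (_* 1) (W≡f r)
    walkWeight-by-source W≡f (u ∷ v ∷ vs) (r ∷ l) = cong₂ _*_ (W≡f r) (walkWeight-by-source W≡f (v ∷ vs) l)

    walkWeight-by-target : ∀ {g : A → ℕ} → (∀ {x y} → R x y → W x y ≡ g y) →
      ∀ {x} xs → Linked R (x ∷ xs) → walkWeight W (x ∷ xs) ≡ product (map g xs)
    walkWeight-by-target W≡g []       _       = refl
    walkWeight-by-target W≡g (y ∷ ys) (r ∷ l) = cong₂ _*_ (W≡g r) (walkWeight-by-target W≡g ys l)

-- n ! / k, the exact integer stand-in for 1/k; junk value 0 at k = 0.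
recip : ℕ → ℕ → ℕ
recip n zero    = 0
recip n (suc k) = n ! / suc k

recip-*≤ : ∀ n k → recip n k * k ≤ n !
recip-*≤ n zero    = z≤n
recip-*≤ n (suc k) = m/n*n≤m (n !) (suc k)

recip-*≡ : ∀ {n k} → 1 ≤ k → k ≤ n → recip n k * k ≡ n !
recip-*≡ {n} {suc k} _ k≤n = m/n*n≡m (∣-trans (m∣m*n (k !)) (m≤n⇒m!∣n! k≤n))

module _ {n F : ℕ} (W : Fin n → Fin n → ℕ) where

  ∑-walkWeight-from : (∀ x → ∑[ y ∈ allFin n ] W x y ≤ F) →
    ∀ m x → ∑[ v ∈ allVecs m n ] walkWeight W (x ∷ toList v) ≤ F ^ m
  ∑-walkWeight-from rows≤F zero    x = ≤-refl
  ∑-walkWeight-from rows≤F (suc m) x = begin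
    ∑[ v ∈ allVecs (suc m) n ] walkWeight W (x ∷ toList v)                  ≡⟨ ∑-allVecs-∷ m n _ ⟩
    ∑[ y ∈ allFin n ] ∑[ u ∈ allVecs m n ] (W x y * walkWeight W (y ∷ toList u))
      ≡⟨ ∑-cong (allFin n) (λ y → ∑-*ˡ (W x y) _ (allVecs m n)) ⟩
    ∑[ y ∈ allFin n ] (W x y * ∑[ u ∈ allVecs m n ] walkWeight W (y ∷ toList u))
      ≤⟨ ∑-mono (allFin n) (λ y → *-monoʳ-≤ (W x y) (∑-walkWeight-from rows≤F m y)) ⟩
    ∑[ y ∈ allFin n ] (W x y * F ^ m)                                       ≡⟨ ∑-*ʳ (F ^ m) (W x) (allFin n) ⟩
    (∑[ y ∈ allFin n ] W x y) * F ^ m                                       ≤⟨ *-monoˡ-≤ (F ^ m) (rows≤F x) ⟩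
    F * F ^ m                                                               ∎
    where open ≤-Reasoning

  ∑-walkWeight-rows : (∀ x → ∑[ y ∈ allFin n ] W x y ≤ F) →
    ∀ m → ∑[ v ∈ allVecs (suc m) n ] walkWeight W (toList v) ≤ n * F ^ m
  ∑-walkWeight-rows rows≤F m = begin
    ∑[ v ∈ allVecs (suc m) n ] walkWeight W (toList v)                       ≡⟨ ∑-allVecs-∷ m n _ ⟩
    ∑[ x ∈ allFin n ] ∑[ u ∈ allVecs m n ] walkWeight W (x ∷ toList u)       ≤⟨ ∑-mono (allFin n) (∑-walkWeight-from rows≤F m) ⟩
    ∑[ x ∈ allFin n ] (F ^ m)                                                ≡⟨ ∑-allFin-const n (F ^ m) ⟩
    n * F ^ m                                                                ∎
    where open ≤-Reasoning

  ∑-walkWeight-columns : (∀ y → ∑[ x ∈ allFin n ] W x y ≤ F) →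
    ∀ m → ∑[ v ∈ allVecs (suc m) n ] walkWeight W (toList v) ≤ n * F ^ m
  ∑-walkWeight-columns cols≤F zero    = ≤-reflexive (trans (∑-allVecs-∷ zero n _) (∑-allFin-const n 1))
  ∑-walkWeight-columns cols≤F (suc m) = begin
    ∑[ v ∈ allVecs (suc (suc m)) n ] walkWeight W (toList v)
      ≡⟨ ∑-allVecs-∷ (suc m) n _ ⟩
    ∑[ x ∈ allFin n ] ∑[ v ∈ allVecs (suc m) n ] walkWeight W (x ∷ toList v)
      ≡⟨ ∑-cong (allFin n) (λ x → trans (∑-allVecs-∷ m n _) (∑-cong (allFin n) (λ y → ∑-*ˡ (W x y) _ (allVecs m n)))) ⟩
    ∑[ x ∈ allFin n ] ∑[ y ∈ allFin n ] (W x y * walksFrom y)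
      ≡⟨ ∑-swap (λ x y → W x y * walksFrom y) (allFin n) (allFin n) ⟩
    ∑[ y ∈ allFin n ] ∑[ x ∈ allFin n ] (W x y * walksFrom y)
      ≡⟨ ∑-cong (allFin n) (λ y → ∑-*ʳ (walksFrom y) (λ x → W x y) (allFin n)) ⟩
    ∑[ y ∈ allFin n ] ((∑[ x ∈ allFin n ] W x y) * walksFrom y)
      ≤⟨ ∑-mono (allFin n) (λ y → *-monoˡ-≤ (walksFrom y) (cols≤F y)) ⟩
    ∑[ y ∈ allFin n ] (F * walksFrom y)
      ≡⟨ ∑-*ˡ F walksFrom (allFin n) ⟩
    F * ∑[ y ∈ allFin n ] walksFrom y
      ≡⟨ cong (F *_) (∑-allVecs-∷ m n _) ⟨
    F * ∑[ v ∈ allVecs (suc m) n ] walkWeight W (toList v)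
      ≤⟨ *-monoʳ-≤ F (∑-walkWeight-columns cols≤F m) ⟩
    F * (n * F ^ m)
      ≡⟨ *-x∙yz≈y∙xz F n (F ^ m) ⟩
    n * (F * F ^ m)
      ∎
    where
    open ≤-Reasoning
    walksFrom : Fin n → ℕ
    walksFrom y = ∑[ u ∈ allVecs m n ] walkWeight W (y ∷ toList u)

next-inject₁ : ∀ {m} (i : Fin m) → next {suc m} (inject₁ i) ≡ suc i
next-inject₁ {m} i = toℕ-injective (begin
  toℕ (next (inject₁ i))         ≡⟨ toℕ-fromℕ< _ ⟩
  suc (toℕ (inject₁ i)) % suc m  ≡⟨ cong (λ j → suc j % suc m) (toℕ-inject₁ i) ⟩
  suc (toℕ i) % suc m            ≡⟨ m≤n⇒m%n≡m (toℕ<n i) ⟩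
  suc (toℕ i)                    ∎)
  where open ≡-Reasoning

next-fromℕ : ∀ m → next {suc m} (fromℕ m) ≡ zero
next-fromℕ m = toℕ-injective (begin
  toℕ (next (fromℕ m))           ≡⟨ toℕ-fromℕ< _ ⟩
  suc (toℕ (fromℕ m)) % suc m    ≡⟨ cong (λ j → suc j % suc m) (toℕ-fromℕ m) ⟩
  suc m % suc m                  ≡⟨ n%n≡0 (suc m) ⟩
  0                              ∎)
  where open ≡-Reasoning

Linked-lookup : ∀ {R : A → A → Set} {m y} (c : Vec A (suc m)) →
  (∀ (i : Fin m) → R (lookup c (inject₁ i)) (lookup c (suc i))) → R (lookup c (fromℕ m)) y →
  Linked R (toList c ∷ʳ y)
Linked-lookup {m = zero}  (x ∷ [])     steps last = last ∷ [-]
Linked-lookup {m = suc m} (x ∷ x′ ∷ c) steps last = steps zero ∷ Linked-lookup (x′ ∷ c) (steps ∘ suc) last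

module Counting {n : ℕ} (G : OrientedGraph n) where

  adj : Fin n → Fin n → ℕ
  adj u v = indicator (arc? G u v)

  adj-arc : ∀ {u v} → Arc G u v → adj u v ≡ 1
  adj-arc {u} {v} uv with arc? G u v
  ... | yes _  = refl
  ... | no ¬uv = ⊥-elim (¬uv uv)

  adj≤1 : ∀ u v → adj u v ≤ 1
  adj≤1 u v with arc? G u v
  ... | yes _ = ≤-refl
  ... | no  _ = z≤n

  neighbour-indicator : ∀ v u → indicator (neighbour? G v u) ≡ adj v u + adj u v
  neighbour-indicator v u with arc? G v u | arc? G u v
  ... | yes vu | yes uv = ⊥-elim (oriented G v u (vu , uv))
  ... | yes _  | no  _  = refl
  ... | no  _  | yes _  = refl
  ... | no  _  | no  _  = refl

  outdeg indeg : Fin n → ℕ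
  outdeg u = ∑[ v ∈ allFin n ] adj u v
  indeg  v = ∑[ u ∈ allFin n ] adj u v

  outdeg≤n : ∀ u → outdeg u ≤ n
  outdeg≤n u = ≤-trans (∑-mono (allFin n) (adj≤1 u)) (≤-reflexive (trans (∑-allFin-const n 1) (*-identityʳ n)))

  indeg≤n : ∀ v → indeg v ≤ n
  indeg≤n v = ≤-trans (∑-mono (allFin n) (λ u → adj≤1 u v)) (≤-reflexive (trans (∑-allFin-const n 1) (*-identityʳ n)))

  outdeg-arc : ∀ {u v} → Arc G u v → 1 ≤ outdeg u
  outdeg-arc {u} {v} uv = subst (_≤ outdeg u) (adj-arc uv) (∑-∈ (adj u) (∈-allFin v))

  indeg-arc : ∀ {u v} → Arc G u v → 1 ≤ indeg v
  indeg-arc {u} {v} uv = subst (_≤ indeg v) (adj-arc uv) (∑-∈ (λ w → adj w v) (∈-allFin u))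

  ∑-neighboursIn : ∀ {k} (c : Vec (Fin n) k) →
    ∑[ v ∈ allFin n ] neighboursIn G c v ≡ ∑[ u ∈ toList c ] (indeg u + outdeg u)
  ∑-neighboursIn {k} c = begin
    ∑[ v ∈ allFin n ] neighboursIn G c v
      ≡⟨ ∑-cong (allFin n) (λ v → trans (length-filter≡∑ _ (allFin k)) (∑-allFin-lookup (λ u → indicator (neighbour? G v u)) c)) ⟩
    ∑[ v ∈ allFin n ] ∑[ u ∈ toList c ] indicator (neighbour? G v u)  ≡⟨ ∑-swap _ (allFin n) (toList c) ⟩
    ∑[ u ∈ toList c ] ∑[ v ∈ allFin n ] indicator (neighbour? G v u)
      ≡⟨ ∑-cong (toList c) (λ u → trans (∑-cong (allFin n) (λ v → neighbour-indicator v u)) (∑-+ _ _ (allFin n))) ⟩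
    ∑[ u ∈ toList c ] (indeg u + outdeg u)                              ∎
    where open ≡-Reasoning

  recipOut recipIn : Fin n → ℕ
  recipOut u = recip n (outdeg u)
  recipIn  v = recip n (indeg v)

  -- (n !) ^ (|w| - 1) times the probability that the random walk choosing a uniform out-neighbour
  -- (resp. in-neighbour, walking backwards) follows w.
  forward backward : List (Fin n) → ℕ
  forward  = walkWeight (λ u v → adj u v * recipOut u)
  backward = walkWeight (λ u v → adj u v * recipIn v)

  ∑-forward : ∀ m → ∑[ v ∈ allVecs (suc m) n ] forward (toList v) ≤ n * (n !) ^ m
  ∑-forward = ∑-walkWeight-rows _ λ u → begin
    ∑[ v ∈ allFin n ] (adj u v * recipOut u)  ≡⟨ ∑-*ʳ (recipOut u) (adj u) (allFin n) ⟩
    outdeg u * recipOut u                     ≡⟨ *-comm (outdeg u) (recipOut u) ⟩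
    recipOut u * outdeg u                     ≤⟨ recip-*≤ n (outdeg u) ⟩
    n !                                       ∎
    where open ≤-Reasoning

  ∑-backward : ∀ m → ∑[ v ∈ allVecs (suc m) n ] backward (toList v) ≤ n * (n !) ^ m
  ∑-backward = ∑-walkWeight-columns _ λ v → begin
    ∑[ u ∈ allFin n ] (adj u v * recipIn v)   ≡⟨ ∑-*ʳ (recipIn v) (λ u → adj u v) (allFin n) ⟩
    indeg v * recipIn v                       ≡⟨ *-comm (indeg v) (recipIn v) ⟩
    recipIn v * indeg v                       ≤⟨ recip-*≤ n (indeg v) ⟩
    n !                                       ∎
    where open ≤-Reasoning

  CycleWalk : List (Fin n) → Set
  CycleWalk = ClosedWalk (Arc G)

  adj-arc-* : ∀ {u v} (f : Fin n → ℕ) (x : Fin n) → Arc G u v → adj u v * f x ≡ f x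
  adj-arc-* f x uv = trans (cong (_* f x) (adj-arc uv)) (*-identityˡ (f x))

  forward-rotate : ∀ {x xs} → CycleWalk (x ∷ xs) →
    forward (rotate (x ∷ xs)) * recipOut x ≡ product (map recipOut (x ∷ xs))
  forward-rotate {x} {xs} cw = begin
    forward (xs ∷ʳ x) * recipOut x
      ≡⟨ cong (_* recipOut x) (walkWeight-by-source (adj-arc-* recipOut _) xs (Linked.tail cw)) ⟩
    product (map recipOut xs) * recipOut x  ≡⟨ *-comm _ (recipOut x) ⟩
    product (map recipOut (x ∷ xs))         ∎
    where open ≡-Reasoning

  backward-head : ∀ {x xs} → CycleWalk (x ∷ xs) →
    backward (x ∷ xs) * recipIn x ≡ product (map recipIn (x ∷ xs))
  backward-head {x} {xs} cw = begin
    backward (x ∷ xs) * recipIn x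
      ≡⟨ cong (_* recipIn x) (walkWeight-by-target (adj-arc-* recipIn _) xs (Linked-∷ʳ⁻ (x ∷ xs) cw)) ⟩
    product (map recipIn xs) * recipIn x   ≡⟨ *-comm _ (recipIn x) ⟩
    product (map recipIn (x ∷ xs))         ∎
    where open ≡-Reasoning

  labelledCycle⇒cycleWalk : ∀ {m} (c : Vec (Fin n) (suc m)) → IsLabelledCycle G c → CycleWalk (toList c)
  labelledCycle⇒cycleWalk {m} c@(_ ∷ _) (_ , arcs) = Linked-lookup c
    (λ i → subst (Arc G (lookup c (inject₁ i)) ∘ lookup c) (next-inject₁ i) (arcs (inject₁ i)))
    (subst (Arc G (lookup c (fromℕ m)) ∘ lookup c) (next-fromℕ m) (arcs (fromℕ m)))

  outdeg*recipOut : ∀ {w} → CycleWalk w → product (map outdeg w) * product (map recipOut w) ≡ (n !) ^ length w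
  outdeg*recipOut cw = product-map-* (All.map exact (closedWalk-successors cw))
    where
    exact : ∀ {u} → ∃ (Arc G u) → outdeg u * recipOut u ≡ n !
    exact {u} (_ , uv) = trans (*-comm (outdeg u) _) (recip-*≡ (outdeg-arc uv) (outdeg≤n u))

  indeg*recipIn : ∀ {w} → CycleWalk w → product (map indeg w) * product (map recipIn w) ≡ (n !) ^ length w
  indeg*recipIn cw = product-map-* (All.map exact (closedWalk-predecessors cw))
    where
    exact : ∀ {v} → ∃ (λ u → Arc G u v) → indeg v * recipIn v ≡ n !
    exact {v} (_ , uv) = trans (*-comm (indeg v) _) (recip-*≡ (indeg-arc uv) (indeg≤n v))

  recipOut-product≢0 : ∀ {w} → CycleWalk w → NonZero (product (map recipOut w))
  recipOut-product≢0 {w} cw = m*n≢0⇒n≢0 (product (map outdeg w))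
    {{subst NonZero (sym (outdeg*recipOut cw)) (m^n≢0 (n !) (length w) {{n !≢0}})}}

  recipIn-product≢0 : ∀ {w} → CycleWalk w → NonZero (product (map recipIn w))
  recipIn-product≢0 {w} cw = m*n≢0⇒n≢0 (product (map indeg w))
    {{subst NonZero (sym (indeg*recipIn cw)) (m^n≢0 (n !) (length w) {{n !≢0}})}}

  product-forward-rotations : ∀ {m w} → CycleWalk w → length w ≡ suc m →
    product (map (forward ∘ rotate) (rotations (suc m) w)) ≡ product (map recipOut w) ^ m
  product-forward-rotations cw |w| = product-rotations {P = CycleWalk} closedWalk-rotate (λ ()) recipOut (forward ∘ rotate) forward-rotate
                                       cw |w| {{recipOut-product≢0 cw}}

  product-backward-rotations : ∀ {m w} → CycleWalk w → length w ≡ suc m →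
    product (map backward (rotations (suc m) w)) ≡ product (map recipIn w) ^ m
  product-backward-rotations cw |w| = product-rotations {P = CycleWalk} closedWalk-rotate (λ ()) recipIn backward backward-head
                                        cw |w| {{recipIn-product≢0 cw}}

  -- For each rotation x ∷ xs of w: the backward weight of the path leaving x and the forward
  -- weight of the path ending at x.
  cycleTerms : ℕ → List (Fin n) → List ℕ
  cycleTerms k w = map backward (rotations k w) ++ map (forward ∘ rotate) (rotations k w)

  cycleSum : ∀ {k} → Vec (Fin n) k → ℕ
  cycleSum {k} c = sum (cycleTerms k (toList c))

  degreeSum-bound : ∀ {k d} (c : Vec (Fin n) k) → (∀ v → d * neighboursIn G c v ≤ 2 * k) →
    d * ∑[ u ∈ toList c ] (indeg u + outdeg u) ≤ n * (2 * k)
  degreeSum-bound {k} {d} c nbrs≤ = begin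
    d * ∑[ u ∈ toList c ] (indeg u + outdeg u)  ≡⟨ cong (d *_) (∑-neighboursIn c) ⟨
    d * ∑[ v ∈ allFin n ] neighboursIn G c v    ≡⟨ ∑-*ˡ d (neighboursIn G c) (allFin n) ⟨
    ∑[ v ∈ allFin n ] (d * neighboursIn G c v)  ≤⟨ ∑-mono (allFin n) nbrs≤ ⟩
    ∑[ v ∈ allFin n ] (2 * k)                   ≡⟨ ∑-allFin-const n (2 * k) ⟩
    n * (2 * k)                                 ∎
    where open ≤-Reasoning

  cycleTerms-amgm : ∀ {m w} → CycleWalk w → length w ≡ suc m → let E = suc m + suc m in
    E ^ E * (product (map recipIn w) ^ m * product (map recipOut w) ^ m) ≤ sum (cycleTerms (suc m) w) ^ E
  cycleTerms-amgm {m} {w} cw |w| = subst (λ p → E ^ E * p ≤ sum (cycleTerms K w) ^ E)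
    (trans (product-++ (map backward rots) _) (cong₂ _*_ (product-backward-rotations cw |w|) (product-forward-rotations cw |w|)))
    (amgm-at (cycleTerms K w) |terms|)
    where
    K = suc m
    E = K + K
    rots = rotations K w
    |terms| : length (cycleTerms K w) ≡ E
    |terms| = trans (length-++ (map backward rots)) (cong₂ _+_ (trans (length-map backward rots) (length-rotations K w))
                                                               (trans (length-map (forward ∘ rotate) rots) (length-rotations K w)))
    amgm-at : ∀ xs {L} → length xs ≡ L → L ^ L * product xs ≤ sum xs ^ L
    amgm-at xs refl = amgm xs

  degrees-amgm : ∀ {m d} (c : Vec (Fin n) (suc m)) → (∀ v → d * neighboursIn G c v ≤ 2 * suc m) →
    let E = suc m + suc m; w = toList c in
    d ^ E * (product (map indeg w) * product (map outdeg w)) ≤ n ^ E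
  degrees-amgm {m} {d} c nbrs≤ = subst (λ p → d ^ E * p ≤ n ^ E) (product-++ (map indeg w) _) (amgm-bound-at degs |degs| (begin
    d * sum degs                               ≡⟨ cong (d *_) (trans (sum-++ (map indeg w) _) (sym (∑-+ indeg outdeg w))) ⟩
    d * ∑[ u ∈ w ] (indeg u + outdeg u)        ≤⟨ degreeSum-bound {d = d} c nbrs≤ ⟩
    n * (2 * K)                                ≡⟨ cong (λ j → n * (K + j)) (+-identityʳ K) ⟩
    n * E                                      ∎))
    where
    open ≤-Reasoning
    K = suc m
    E = K + K
    w = toList c
    degs = map indeg w ++ map outdeg w
    |w| : length w ≡ K
    |w| = length-toList c
    |degs| : length degs ≡ E
    |degs| = trans (length-++ (map indeg w)) (cong₂ _+_ (trans (length-map indeg w) |w|) (trans (length-map outdeg w) |w|))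
    amgm-bound-at : ∀ xs {L} → length xs ≡ L → d * sum xs ≤ n * L → d ^ L * product xs ≤ n ^ L
    amgm-bound-at xs refl = amgm-bound xs

  cycleSum-bound : ∀ {m d} (c : Vec (Fin n) (suc m)) → IsLabelledCycle G c →
    (∀ v → d * neighboursIn G c v ≤ 2 * suc m) →
    (suc m + suc m) * (n !) ^ m * d ^ m ≤ n ^ m * cycleSum c
  cycleSum-bound {m} {d} c isCycle nbrs≤ =
    cycle-arithmetic m {n} {d} {n !} {cycleSum c} {∏ indeg} {∏ outdeg} {∏ recipIn} {∏ recipOut}
      (trans (indeg*recipIn cw) (cong ((n !) ^_) |w|))
      (trans (outdeg*recipOut cw) (cong ((n !) ^_) |w|))
      (degrees-amgm {d = d} c nbrs≤)
      (cycleTerms-amgm cw |w|)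
    where
    w = toList c
    ∏ : (Fin n → ℕ) → ℕ
    ∏ f = product (map f w)
    cw = labelledCycle⇒cycleWalk c isCycle
    |w| = length-toList c

  ∑-cycleSum : ∀ m → ∑[ c ∈ allVecs (suc m) n ] cycleSum c ≤ suc m * (n * (n !) ^ m + n * (n !) ^ m)
  ∑-cycleSum m = begin
    ∑[ c ∈ Vs ] cycleSum c
      ≡⟨ ∑-cong Vs (λ c → trans (sum-++ (map backward (rotations K (toList c))) _)
                                (sym (∑-+ backward (forward ∘ rotate) (rotations K (toList c))))) ⟩
    ∑[ c ∈ Vs ] ∑[ ρ ∈ rotations K (toList c) ] (backward ρ + forward (rotate ρ))
      ≡⟨ ∑-allVecs-rotations m n K _ ⟩
    K * ∑[ c ∈ Vs ] (backward (toList c) + forward (rotate (toList c)))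
      ≡⟨ cong (K *_) (trans (∑-+ _ _ Vs) (cong (∑[ c ∈ Vs ] backward (toList c) +_) (∑-allVecs-rotate m n forward))) ⟩
    K * (∑[ c ∈ Vs ] backward (toList c) + ∑[ c ∈ Vs ] forward (toList c))
      ≤⟨ *-monoʳ-≤ K (+-mono-≤ (∑-backward m) (∑-forward m)) ⟩
    K * (n * (n !) ^ m + n * (n !) ^ m)  ∎
    where
    open ≤-Reasoning
    K = suc m
    Vs = allVecs K n

  labelledCycles-bound : ∀ m d → (∀ c → IsLabelledCycle G c → ∀ v → d * neighboursIn G c v ≤ 2 * suc m) →
    length (labelledCycles (suc m) G) * d ^ m ≤ n ^ suc m
  labelledCycles-bound m d nbrs≤ = *-cancelˡ-≤ (E * Fᵐ) {{m*n≢0 E Fᵐ {{_}} {{m^n≢0 (n !) m {{n !≢0}}}}}} (begin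
    E * Fᵐ * (L * d ^ m)                            ≡⟨ shuffle E Fᵐ L (d ^ m) ⟩
    L * C                                           ≡⟨ cong (_* C) (length-filter≡∑ (isLabelledCycle? G) Vs) ⟩
    (∑[ c ∈ Vs ] isCycle c) * C                     ≡⟨ ∑-*ʳ C isCycle Vs ⟨
    ∑[ c ∈ Vs ] (isCycle c * C)                     ≤⟨ ∑-mono Vs cycle-weight ⟩
    ∑[ c ∈ Vs ] (n ^ m * cycleSum c)                ≡⟨ ∑-*ˡ (n ^ m) cycleSum Vs ⟩
    n ^ m * ∑[ c ∈ Vs ] cycleSum c                  ≤⟨ *-monoʳ-≤ (n ^ m) (∑-cycleSum m) ⟩
    n ^ m * (K * (n * Fᵐ + n * Fᵐ))                 ≡⟨ collect (n ^ m) K n Fᵐ ⟩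
    E * Fᵐ * (n * n ^ m)                            ∎)
    where
    open ≤-Reasoning
    K = suc m
    E = K + K
    Fᵐ = (n !) ^ m
    C = E * Fᵐ * d ^ m
    Vs = allVecs K n
    L = length (labelledCycles K G)
    isCycle : Vec (Fin n) K → ℕ
    isCycle c = indicator (isLabelledCycle? G c)
    cycle-weight : ∀ c → isCycle c * C ≤ n ^ m * cycleSum c
    cycle-weight c with isLabelledCycle? G c
    ... | yes cyc = ≤-trans (≤-reflexive (+-identityʳ C)) (cycleSum-bound c cyc (nbrs≤ c cyc))
    ... | no  _   = z≤n
    shuffle : ∀ e f l x → e * f * (l * x) ≡ l * (e * f * x)
    shuffle = solve-∀
    collect : ∀ nᵐ k n f → nᵐ * (k * (n * f + n * f)) ≡ (k + k) * f * (n * nᵐ)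
    collect = solve-∀

lemma3p5 : (k d n : ℕ) → 3 ≤ k → 1 ≤ d → (G : OrientedGraph n) →
    (∀ (c : Vec (Fin n) k) → IsLabelledCycle G c →
       ∀ (v : Fin n) → d * neighboursIn G c v ≤ 2 * k) →
    numCopies k G * (k * d ^ (k ∸ 1)) ≤ n ^ k
lemma3p5 (suc m) d n _ _ G nbrs≤ = begin
  L / suc m * (suc m * d ^ m)   ≡⟨ *-assoc (L / suc m) (suc m) (d ^ m) ⟨
  L / suc m * suc m * d ^ m     ≤⟨ *-monoˡ-≤ (d ^ m) (m/n*n≤m L (suc m)) ⟩
  L * d ^ m                     ≤⟨ Counting.labelledCycles-bound G m d nbrs≤ ⟩
  n ^ suc m                     ∎
  where
  open ≤-Reasoning
  L = length (labelledCycles (suc m) G)
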